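{- Let $G$ be a finite simple claw-free graph (i.e., $G$ has no induced subgraph isomorphic to $K_{1,3}$) on $n$ vertices whose list chromatic number is $s$. Then for every integer $t$ with $0 < t < s$, $\lambda_t(G) \geq \frac{tn}{s}$.
   Context: For a graph $G$ and a positive integer $k$, a $k$-assignment is a function assigning to each vertex $v$ a list $l(v)$ of exactly $k$ colours. $G$ is $\mathcal{L}$-list colourable if there is a proper vertex colouring in which each vertex $v$ receives a colour from $l(v)$; $G$ is $k$-choosable if it is $\mathcal{L}$-list colourable for every $k$-assignment $\mathcal{L}$. The list chromatic number $\chi_L(G)$ is the least $k$ such that $G$ is $k$-choosable. For a $t$-assignment $\mathcal{L}_t$, $\lambda_{\mathcal{L}_t}(G)$ is the maximum number of vertices of an induced subgraph of $G$ that is $\mathcal{L}_t$-list colourable (with the lists restricted to its vertices), and $\lambda_t(G) = \min\{\lambda_{\mathcal{L}_t}(G) : \mathcal{L}_t \text{ a } t\text{ -assignment for } G\}$. -}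

module Defs where

open import Data.Nat using (ℕ; _<_; _*_; _≤_)
open import Data.Fin using (Fin)
open import Data.Fin.Subset using (Subset; _∈_; ∣_∣)
open import Data.List using (List; length)
open import Data.List.Relation.Unary.Unique.Propositional using (Unique)
import Data.List.Membership.Propositional as LM
open import Data.Product using (Σ; _×_; ∃)
open import Relation.Nullary using (¬_; Dec)
open import Relation.Binary.PropositionalEquality using (_≡_; _≢_)
open import Level using (0ℓ; suc)

record Graph (n : ℕ) : Set₁ where
  field
    Adj   : Fin n → Fin n → Set
    sym   : ∀ {u v} → Adj u v → Adj v u
    irrefl : ∀ {v} → ¬ Adj v v
    dec   : ∀ u v → Dec (Adj u v)
open Graph public

ClawFree : ∀ {n} → Graph n → Set
ClawFree {n} G = ∀ (c a b d : Fin n) →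
  Adj G c a → Adj G c b → Adj G c d →
  a ≢ b → a ≢ d → b ≢ d →
  ¬ (¬ Adj G a b × ¬ Adj G a d × ¬ Adj G b d)

record Assignment (n k : ℕ) : Set where
  field
    lst    : Fin n → List ℕ
    size   : ∀ v → length (lst v) ≡ k
    unique : ∀ v → Unique (lst v)
open Assignment public

ListColourableOn : ∀ {n k} → Graph n → Assignment n k → Subset n → Set
ListColourableOn {n} G L S = Σ (Fin n → ℕ) λ c →
  (∀ v → v ∈ S → c v LM.∈ lst L v) ×
  (∀ u v → u ∈ S → v ∈ S → Adj G u v → c u ≢ c v)

ListColourable : ∀ {n k} → Graph n → Assignment n k → Set
ListColourable {n} G L = Σ (Fin n → ℕ) λ c →
  (∀ v → c v LM.∈ lst L v) × (∀ u v → Adj G u v → c u ≢ c v)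

Choosable : ∀ {n} → Graph n → ℕ → Set
Choosable {n} G k = (L : Assignment n k) → ListColourable G L

ListChromaticNumber : ∀ {n} → Graph n → ℕ → Set
ListChromaticNumber G s = Choosable G s × (∀ k → k < s → ¬ Choosable G k)

-- λ_{L}(G) ≥ m : some induced subgraph on at least m vertices is L-colourable.
-- λ_t(G) ≥ t n / s is expressed multiplied out: for every t-assignment L there
-- is S with G[S] L-colourable and s * |S| ≥ t * n.
LambdaBound : ∀ {n} → Graph n → (t s : ℕ) → Set
LambdaBound {n} G t s = (L : Assignment n t) →
  Σ (Subset n) λ S → ListColourableOn G L S × t * n ≤ s * ∣ S ∣

module Submission where

-- Extend every list by the same s − t fresh colours M + i (M exceeds all listed colours) and
-- take a proper colouring from the extended lists that cannot be improved in the number of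
-- "old" vertices, those keeping a colour below M. For every fresh colour β and old colour a,
-- the β-coloured vertices listing a are then at most as many as the a-coloured ones:
-- otherwise, since the class of β is independent and G is claw-free, each vertex has at most
-- two β-coloured neighbours, so repeatedly discarding an a-coloured vertex that has a
-- β-coloured neighbour not listing a, together with its remaining neighbour among the
-- β-coloured vertices listing a, leaves sets A (colour β, listing a) and B (colour a),
-- closed under adjacency between the two classes, with |B| < |A|; swapping a
-- and β on A ∪ B gains |A| − |B| old vertices. Summing over a gives t·|class β| ≤ #old, and
-- summing over β gives t·(n − #old) ≤ (s − t)·#old, i.e. t·n ≤ s·#old; the old vertices are
-- L-colourable by their current colours.

open import Defs
open import Level using (0ℓ)
open import Data.Bool using (if_then_else_)
open import Data.Empty using (⊥)
open import Data.Fin using (Fin; zero; suc; toℕ)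
open import Data.Fin.Properties using (any?; all?; ¬∀⟶∃¬; toℕ-injective; toℕ<n)
  renaming (_≟_ to _≟ᶠ_)
import Data.Fin.Subset as Sub
open Sub using (Subset)
open import Data.List using (List; []; _∷_; length; _++_; applyUpTo)
open import Data.List.Extrema.Nat using (max; xs≤max)
open import Data.List.Properties using (length-++; length-applyUpTo)
open import Data.List.Relation.Unary.All as All using (All; _∷_)
open import Data.List.Relation.Unary.AllPairs using (_∷_)
open import Data.List.Relation.Unary.Any using (here; there)
open import Data.List.Relation.Unary.Unique.Propositional using (Unique)
import Data.List.Relation.Unary.Unique.Propositional.Properties as Unique
open import Data.Nat
open import Data.Nat.Properties
open import Data.List.Membership.DecPropositional _≟_ using (_∈_; _∈?_)
open import Data.List.Membership.Propositional.Properties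
  using (∈-++⁺ˡ; ∈-++⁺ʳ; ∈-++⁻; ∈-applyUpTo⁺; ∈-applyUpTo⁻)
open import Data.Product using (Σ; ∃; ∃-syntax; _×_; _,_; proj₁; proj₂)
open import Data.Sum using (_⊎_; inj₁; inj₂)
open import Data.Vec using (tabulate)
open import Data.Vec.Properties using ([]=⇒lookup; lookup∘tabulate)
open import Function using (_∘_; id)
open import Relation.Nullary using (¬_; Dec; yes; no; does; contradiction)
open import Relation.Nullary.Decidable using (_×-dec_; ¬?; decidable-stable)
open import Relation.Unary using (Pred; Decidable; _⊆_)
import Relation.Binary.PropositionalEquality as ≡
open ≡ using (_≡_; _≢_; refl; cong; subst)
open import Algebra.Properties.Semiring.Sum +-*-semiring
  using (sum; sum-syntax; sum-cong-≗; sum-replicate-zero; ∑-distrib-+; ∑-comm; *-distribˡ-sum; *-distribʳ-sum)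


𝟙 : ∀ {p} {P : Set p} → Dec P → ℕ
𝟙 d = if does d then 1 else 0

module _ {p} {P : Set p} where

  𝟙-yes : (d : Dec P) → P → 𝟙 d ≡ 1
  𝟙-yes (yes _) _ = refl
  𝟙-yes (no ¬p) p = contradiction p ¬p

  𝟙-no : (d : Dec P) → ¬ P → 𝟙 d ≡ 0
  𝟙-no (yes p) ¬p = contradiction p ¬p
  𝟙-no (no _) _ = refl

  𝟙≤1 : (d : Dec P) → 𝟙 d ≤ 1
  𝟙≤1 (yes _) = ≤-refl
  𝟙≤1 (no _) = z≤n

module _ {p q} {P : Set p} {Q : Set q} where

  𝟙-cong : (d : Dec P) (e : Dec Q) → (P → Q) → (Q → P) → 𝟙 d ≡ 𝟙 e
  𝟙-cong (yes p) e to from = ≡.sym (𝟙-yes e (to p))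
  𝟙-cong (no ¬p) e to from = ≡.sym (𝟙-no e (¬p ∘ from))

  𝟙-× : (d : Dec P) (e : Dec Q) → 𝟙 (d ×-dec e) ≡ 𝟙 d * 𝟙 e
  𝟙-× (yes _) e = ≡.sym (+-identityʳ (𝟙 e))
  𝟙-× (no _) e = refl

∑-mono-≤ : ∀ {m} {f g : Fin m → ℕ} → (∀ i → f i ≤ g i) → sum f ≤ sum g
∑-mono-≤ {zero} f≤g = z≤n
∑-mono-≤ {suc m} f≤g = +-mono-≤ (f≤g zero) (∑-mono-≤ (f≤g ∘ suc))

∑-const : ∀ m x → ∑[ i < m ] x ≡ m * x
∑-const zero x = refl
∑-const (suc m) x = cong (x +_) (∑-const m x)

∑-𝟙-≟toℕ : ∀ m x → ∑[ i < m ] 𝟙 (x ≟ toℕ i) ≡ 𝟙 (x <? m)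
∑-𝟙-≟toℕ zero x = refl
∑-𝟙-≟toℕ (suc m) zero = cong suc (sum-replicate-zero m)
∑-𝟙-≟toℕ (suc m) (suc x) = ∑-𝟙-≟toℕ m x

∑-𝟙-∈ : ∀ m {xs : List ℕ} → Unique xs → All (_< m) xs → ∑[ a < m ] 𝟙 (toℕ a ∈? xs) ≡ length xs
∑-𝟙-∈ m {[]} _ _ = sum-replicate-zero m
∑-𝟙-∈ m {x ∷ xs} (x∉xs ∷ unique) (x<m ∷ xs<m) = begin
  ∑[ a < m ] 𝟙 (toℕ a ∈? x ∷ xs)                     ≡⟨ sum-cong-≗ {m} (λ a → split a (toℕ a ∈? xs)) ⟩
  ∑[ a < m ] (𝟙 (x ≟ toℕ a) + 𝟙 (toℕ a ∈? xs))       ≡⟨ ∑-distrib-+ {m} (λ a → 𝟙 (x ≟ toℕ a)) (λ a → 𝟙 (toℕ a ∈? xs)) ⟩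
  ∑[ a < m ] 𝟙 (x ≟ toℕ a) + ∑[ a < m ] 𝟙 (toℕ a ∈? xs)
    ≡⟨ ≡.cong₂ _+_ (≡.trans (∑-𝟙-≟toℕ m x) (𝟙-yes (x <? m) x<m)) (∑-𝟙-∈ m unique xs<m) ⟩
  suc (length xs)                                     ∎
  where
  open ≡.≡-Reasoning
  split : ∀ a → Dec (toℕ a ∈ xs) → 𝟙 (toℕ a ∈? x ∷ xs) ≡ 𝟙 (x ≟ toℕ a) + 𝟙 (toℕ a ∈? xs)
  split a (yes a∈xs) rewrite 𝟙-yes (toℕ a ∈? x ∷ xs) (there a∈xs) | 𝟙-yes (toℕ a ∈? xs) a∈xs
                           | 𝟙-no (x ≟ toℕ a) (All.lookup x∉xs a∈xs) = refl
  split a (no a∉xs) rewrite 𝟙-no (toℕ a ∈? xs) a∉xs =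
    ≡.trans (𝟙-cong (toℕ a ∈? x ∷ xs) (x ≟ toℕ a) to (here ∘ ≡.sym)) (≡.sym (+-identityʳ _))
    where
    to : toℕ a ∈ x ∷ xs → x ≡ toℕ a
    to (here a≡x) = ≡.sym a≡x
    to (there a∈xs) = contradiction a∈xs a∉xs

count : ∀ {n ℓ} {P : Pred (Fin n) ℓ} → Decidable P → ℕ
count {n} P? = ∑[ v < n ] 𝟙 (P? v)

count≤n : ∀ {n ℓ} {P : Pred (Fin n) ℓ} (P? : Decidable P) → count P? ≤ n
count≤n {n} P? = ≤-trans (∑-mono-≤ (𝟙≤1 ∘ P?)) (≤-reflexive (≡.trans (∑-const n 1) (*-identityʳ n)))

_-_ : ∀ {n ℓ} → Pred (Fin n) ℓ → Fin n → Pred (Fin n) ℓ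
(P - w) v = P v × v ≢ w

_-?_ : ∀ {n ℓ} {P : Pred (Fin n) ℓ} → Decidable P → (w : Fin n) → Decidable (P - w)
(P? -? w) v = P? v ×-dec ¬? (v ≟ᶠ w)

count-remove : ∀ {n ℓ} {P : Pred (Fin n) ℓ} (P? : Decidable P) {w} → P w → suc (count (P? -? w)) ≡ count P?
count-remove {n} P? {w} Pw = begin
  suc (count (P? -? w))                                    ≡⟨ cong (_+ count (P? -? w)) (≡.sym singleton) ⟩
  ∑[ v < n ] 𝟙 (v ≟ᶠ w) + count (P? -? w)                 ≡⟨ ∑-distrib-+ {n} (λ v → 𝟙 (v ≟ᶠ w)) (λ v → 𝟙 ((P? -? w) v)) ⟨
  ∑[ v < n ] (𝟙 (v ≟ᶠ w) + 𝟙 ((P? -? w) v))               ≡⟨ sum-cong-≗ {n} (λ v → split v (v ≟ᶠ w)) ⟩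
  count P?                                                 ∎
  where
  open ≡.≡-Reasoning
  singleton : ∑[ v < n ] 𝟙 (v ≟ᶠ w) ≡ 1
  singleton = begin
    ∑[ v < n ] 𝟙 (v ≟ᶠ w)           ≡⟨ sum-cong-≗ {n} (λ v → 𝟙-cong (v ≟ᶠ w) (toℕ w ≟ toℕ v)
                                          (cong toℕ ∘ ≡.sym) (≡.sym ∘ toℕ-injective)) ⟩
    ∑[ v < n ] 𝟙 (toℕ w ≟ toℕ v)    ≡⟨ ∑-𝟙-≟toℕ n (toℕ w) ⟩
    𝟙 (toℕ w <? n)                   ≡⟨ 𝟙-yes (toℕ w <? n) (toℕ<n w) ⟩
    1                                ∎
  split : ∀ v → Dec (v ≡ w) → 𝟙 (v ≟ᶠ w) + 𝟙 ((P? -? w) v) ≡ 𝟙 (P? v)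
  split v (yes refl) rewrite 𝟙-yes (v ≟ᶠ v) refl | 𝟙-no ((P? -? v) v) (λ (_ , v≢v) → v≢v refl)
                           | 𝟙-yes (P? v) Pw = refl
  split v (no v≢w) rewrite 𝟙-no (v ≟ᶠ w) v≢w = 𝟙-cong ((P? -? w) v) (P? v) proj₁ (_, v≢w)

count-pos : ∀ {n ℓ} {P : Pred (Fin n) ℓ} (P? : Decidable P) {w} → P w → 0 < count P?
count-pos P? Pw = subst (0 <_) (count-remove P? Pw) z<s

ProperColouring : ∀ {n} → Graph n → (Fin n → ℕ) → Set
ProperColouring G c = ∀ u v → Adj G u v → c u ≢ c v

module _ {n} (G : Graph n) where

  Independent : ∀ {ℓ} → Pred (Fin n) ℓ → Set ℓ
  Independent Z = ∀ {u v} → Z u → Z v → ¬ Adj G u v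

  AtMostTwoNeighboursIn : ∀ {ℓ} → Pred (Fin n) ℓ → Set ℓ
  AtMostTwoNeighboursIn Z = ∀ {y x₁ x₂ x₃} → Adj G y x₁ → Adj G y x₂ → Adj G y x₃ →
    Z x₁ → Z x₂ → Z x₃ → x₁ ≢ x₂ → x₁ ≢ x₃ → x₂ ≢ x₃ → ⊥

  clawFree⇒atMostTwoNeighboursIn : ClawFree G → ∀ {ℓ} {Z : Pred (Fin n) ℓ} →
    Independent Z → AtMostTwoNeighboursIn Z
  clawFree⇒atMostTwoNeighboursIn clawFree independent y~x₁ y~x₂ y~x₃ Zx₁ Zx₂ Zx₃ x₁≢x₂ x₁≢x₃ x₂≢x₃ =
    clawFree _ _ _ _ y~x₁ y~x₂ y~x₃ x₁≢x₂ x₁≢x₃ x₂≢x₃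
      (independent Zx₁ Zx₂ , independent Zx₁ Zx₃ , independent Zx₂ Zx₃)

  colourClass-independent : ∀ {c} → ProperColouring G c → ∀ β → Independent (λ v → c v ≡ β)
  colourClass-independent proper β {u} {v} cu≡β cv≡β u~v = proper u v u~v (≡.trans cu≡β (≡.sym cv≡β))

module Peeling {n} (G : Graph n) {Z : Pred (Fin n) 0ℓ} (Z? : Decidable Z)
               (atMostTwo : AtMostTwoNeighboursIn G Z) where

  record ClosedSurplus (X Y : Pred (Fin n) 0ℓ) : Set₁ where
    field
      A B      : Pred (Fin n) 0ℓ
      A?       : Decidable A
      B?       : Decidable B
      A⊆X      : A ⊆ X
      B⊆Y      : B ⊆ Y
      A-closed : ∀ {u v} → A u → Adj G u v → Y v → B v
      B-closed : ∀ {u v} → B u → Adj G u v → Z v → A v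
      surplus  : count B? < count A?

  closedSurplus-whole : ∀ {X Y} (X? : Decidable X) (Y? : Decidable Y) → count Y? < count X? →
    (∀ {u v} → Y u → Adj G u v → Z v → X v) → ClosedSurplus X Y
  closedSurplus-whole {X} {Y} X? Y? Y<X Y-closed = record
    { A = X ; B = Y ; A? = X? ; B? = Y? ; A⊆X = id ; B⊆Y = id
    ; A-closed = λ _ _ Yv → Yv ; B-closed = Y-closed ; surplus = Y<X }

  closedSurplus-restore : ∀ {X X' Y} y → X' ⊆ X → (∀ {u} → X' u → ¬ Adj G y u) →
    ClosedSurplus X' (Y - y) → ClosedSurplus X Y
  closedSurplus-restore {X} {X'} {Y} y X'⊆X y≁X' S = record
    { A = A ; B = B ; A? = A? ; B? = B? ; A⊆X = X'⊆X ∘ A⊆X ; B⊆Y = proj₁ ∘ B⊆Y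
    ; A-closed = A-closed' ; B-closed = B-closed ; surplus = surplus }
    where
    open ClosedSurplus S
    A-closed' : ∀ {u v} → A u → Adj G u v → Y v → B v
    A-closed' {u} {v} Au u~v Yv with v ≟ᶠ y
    ... | yes refl = contradiction (sym G u~v) (y≁X' (A⊆X Au))
    ... | no v≢y = A-closed Au u~v (Yv , v≢y)

  -- A y ∈ Y with a neighbour z ∈ Z outside X has at most one X-neighbour (z is a third
  -- Z-neighbour), so discarding y together with it keeps |Y| < |X|.
  closedSurplus : ∀ k {X Y} (X? : Decidable X) (Y? : Decidable Y) → X ⊆ Z →
    count Y? ≤ k → count Y? < count X? → ClosedSurplus X Y
  closedSurplus zero X? Y? _ Y≤0 Y<X =
    closedSurplus-whole X? Y? Y<X λ Yu _ _ → contradiction Y≤0 (<⇒≱ (count-pos Y? Yu))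
  closedSurplus (suc k) {X} {Y} X? Y? X⊆Z Y≤1+k Y<X
    with any? (λ y → Y? y ×-dec any? (λ z → dec G y z ×-dec (Z? z ×-dec ¬? (X? z))))
  ... | no noExit = closedSurplus-whole X? Y? Y<X λ Yu u~v Zv →
    decidable-stable (X? _) λ ¬Xv → noExit (_ , Yu , _ , u~v , Zv , ¬Xv)
  ... | yes (y , Yy , z , y~z , Zz , ¬Xz) = discard (any? (λ x → X? x ×-dec dec G y x))
    where
    removeY : suc (count (Y? -? y)) ≡ count Y?
    removeY = count-remove Y? Yy
    Y'≤k : count (Y? -? y) ≤ k
    Y'≤k = s≤s⁻¹ (≤-trans (≤-reflexive removeY) Y≤1+k)
    discard : Dec (∃ λ x → X x × Adj G y x) → ClosedSurplus X Y
    discard (no y≁X) = closedSurplus-restore y id (λ Xu y~u → y≁X (_ , Xu , y~u))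
      (closedSurplus k X? (Y? -? y) X⊆Z Y'≤k (<-trans (≤-reflexive removeY) Y<X))
    discard (yes (x , Xx , y~x)) = closedSurplus-restore y proj₁ (λ (Xu , u≢x) y~u → onlyNeighbour Xu y~u u≢x)
      (closedSurplus k (X? -? x) (Y? -? y) (X⊆Z ∘ proj₁) Y'≤k
        (s<s⁻¹ (≡.subst₂ _<_ (≡.sym removeY) (≡.sym (count-remove X? Xx)) Y<X)))
      where
      onlyNeighbour : ∀ {u} → X u → Adj G y u → u ≢ x → ⊥
      onlyNeighbour Xu y~u u≢x = atMostTwo y~x y~u y~z (X⊆Z Xx) (X⊆Z Xu) Zz
        (u≢x ∘ ≡.sym) (λ x≡z → ¬Xz (subst X x≡z Xx)) (λ u≡z → ¬Xz (subst X u≡z Xu))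

module KempeSwap {n} (G : Graph n) {c : Fin n → ℕ} (proper : ProperColouring G c)
  {α β : ℕ} (α≢β : α ≢ β) {A B : Pred (Fin n) 0ℓ} (A? : Decidable A) (B? : Decidable B)
  (A⊆β : ∀ {v} → A v → c v ≡ β) (B⊆α : ∀ {v} → B v → c v ≡ α)
  (A-closed : ∀ {u v} → A u → Adj G u v → c v ≡ α → B v)
  (B-closed : ∀ {u v} → B u → Adj G u v → c v ≡ β → A v) where

  recolour : ∀ {v} → Dec (A v) → Dec (B v) → ℕ
  recolour (yes _)       _       = α
  recolour (no _)        (yes _) = β
  recolour {v} (no _)    (no _)  = c v

  swapped : Fin n → ℕ
  swapped v = recolour (A? v) (B? v)

  data SwapView (v : Fin n) (x : ℕ) : Set where
    inA     : A v → ¬ B v → x ≡ α → SwapView v x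
    inB     : ¬ A v → B v → x ≡ β → SwapView v x
    outside : ¬ A v → ¬ B v → x ≡ c v → SwapView v x

  view : ∀ v → SwapView v (swapped v)
  view v = classify (A? v) (B? v)
    where
    classify : (a : Dec (A v)) (b : Dec (B v)) → SwapView v (recolour a b)
    classify (yes Av) _       = inA Av (λ Bv → α≢β (≡.trans (≡.sym (B⊆α Bv)) (A⊆β Av))) refl
    classify (no ¬Av) (yes Bv) = inB ¬Av Bv refl
    classify (no ¬Av) (no ¬Bv) = outside ¬Av ¬Bv refl

  differ : ∀ {u v x y} → swapped u ≡ x → swapped v ≡ y → x ≢ y → swapped u ≢ swapped v
  differ su sv x≢y e = x≢y (≡.trans (≡.sym su) (≡.trans e sv))

  swapped-proper : ProperColouring G swapped
  swapped-proper u v u~v with view u | view v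
  ... | inA Au _ _    | inA Av _ _    = λ _ → proper u v u~v (≡.trans (A⊆β Au) (≡.sym (A⊆β Av)))
  ... | inA _ _ su    | inB _ _ sv    = differ su sv α≢β
  ... | inA Au _ su   | outside _ ¬Bv sv = differ su sv λ α≡cv → ¬Bv (A-closed Au u~v (≡.sym α≡cv))
  ... | inB _ _ su    | inA _ _ sv    = differ su sv (α≢β ∘ ≡.sym)
  ... | inB _ Bu _    | inB _ Bv _    = λ _ → proper u v u~v (≡.trans (B⊆α Bu) (≡.sym (B⊆α Bv)))
  ... | inB _ Bu su   | outside ¬Av _ sv = differ su sv λ β≡cv → ¬Av (B-closed Bu u~v (≡.sym β≡cv))
  ... | outside _ ¬Bu su | inA Av _ sv = differ su sv λ cu≡α → ¬Bu (A-closed Av (sym G u~v) cu≡α)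
  ... | outside ¬Au _ su | inB _ Bv sv = differ su sv λ cu≡β → ¬Au (B-closed Bv (sym G u~v) cu≡β)
  ... | outside _ _ su | outside _ _ sv = differ su sv (proper u v u~v)

  module _ {Q : Pred ℕ 0ℓ} (Q? : Decidable Q) (Qα : Q α) (¬Qβ : ¬ Q β) where

    count-swapped : count (Q? ∘ swapped) + count B? ≡ count (Q? ∘ c) + count A?
    count-swapped = begin
      count (Q? ∘ swapped) + count B?                   ≡⟨ ∑-distrib-+ {n} (𝟙 ∘ Q? ∘ swapped) (𝟙 ∘ B?) ⟨
      ∑[ v < n ] (𝟙 (Q? (swapped v)) + 𝟙 (B? v))       ≡⟨ sum-cong-≗ {n} (λ v → pointwise v (view v)) ⟩
      ∑[ v < n ] (𝟙 (Q? (c v)) + 𝟙 (A? v))             ≡⟨ ∑-distrib-+ {n} (𝟙 ∘ Q? ∘ c) (𝟙 ∘ A?) ⟩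
      count (Q? ∘ c) + count A?                         ∎
      where
      open ≡.≡-Reasoning
      pointwise : ∀ v → SwapView v (swapped v) → 𝟙 (Q? (swapped v)) + 𝟙 (B? v) ≡ 𝟙 (Q? (c v)) + 𝟙 (A? v)
      pointwise v (inA Av ¬Bv s)
        rewrite 𝟙-yes (Q? (swapped v)) (subst Q (≡.sym s) Qα) | 𝟙-no (B? v) ¬Bv
              | 𝟙-no (Q? (c v)) (¬Qβ ∘ subst Q (A⊆β Av)) | 𝟙-yes (A? v) Av = refl
      pointwise v (inB ¬Av Bv s)
        rewrite 𝟙-no (Q? (swapped v)) (¬Qβ ∘ subst Q s) | 𝟙-yes (B? v) Bv
              | 𝟙-yes (Q? (c v)) (subst Q (≡.sym (B⊆α Bv)) Qα) | 𝟙-no (A? v) ¬Av = refl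
      pointwise v (outside ¬Av ¬Bv s)
        rewrite 𝟙-no (B? v) ¬Bv | 𝟙-no (A? v) ¬Av = cong (λ x → 𝟙 (Q? x) + 0) s

    swapped-increases : count B? < count A? → count (Q? ∘ c) < count (Q? ∘ swapped)
    swapped-increases surplus = +-cancelʳ-< (count B?) _ _ (begin-strict
      count (Q? ∘ c) + count B?        <⟨ +-monoʳ-< (count (Q? ∘ c)) surplus ⟩
      count (Q? ∘ c) + count A?        ≡⟨ count-swapped ⟨
      count (Q? ∘ swapped) + count B?  ∎)
      where open ≤-Reasoning

∃-by-bounded-ascent : ∀ {a p} {A : Set a} {P : A → Set p} (f : A → ℕ) {m : ℕ} → (∀ x → f x ≤ m) →
  (∀ x → P x ⊎ ∃[ y ] f x < f y) → A → ∃ P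
∃-by-bounded-ascent {P = P} f {m} bounded step x₀ = climb m x₀ (m≤m+n m (f x₀))
  where
  climb : ∀ k x → m ≤ k + f x → ∃ P
  climb k x m≤k+fx with step x | k
  ... | inj₁ Px          | _      = x , Px
  ... | inj₂ (y , fx<fy) | zero   = contradiction (bounded y) (<⇒≱ (≤-<-trans m≤k+fx fx<fy))
  ... | inj₂ (y , fx<fy) | suc k' = climb k' y (begin
    m               ≤⟨ m≤k+fx ⟩
    suc k' + f x    ≡⟨ +-suc k' (f x) ⟨
    k' + suc (f x)  ≤⟨ +-monoʳ-≤ k' fx<fy ⟩
    k' + f y        ∎)
    where open ≤-Reasoning

listsBounded : ∀ {n} (ls : Fin n → List ℕ) → ∃[ M ] (∀ v {a} → a ∈ ls v → a < M)
listsBounded {zero} ls = 0 , λ ()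
listsBounded {suc n} ls with listsBounded (ls ∘ suc)
... | M , bound = suc (max 0 (ls zero)) ⊔ M , λ where
  zero a∈ → <-≤-trans (s≤s (All.lookup (xs≤max 0 (ls zero)) a∈)) (m≤m⊔n _ M)
  (suc v) a∈ → <-≤-trans (bound v a∈) (m≤n⊔m _ M)

toSubset : ∀ {n ℓ} {P : Pred (Fin n) ℓ} → Decidable P → Subset n
toSubset P? = tabulate (does ∘ P?)

∈-toSubset⁻ : ∀ {n ℓ} {P : Pred (Fin n) ℓ} (P? : Decidable P) {v} → v Sub.∈ toSubset P? → P v
∈-toSubset⁻ P? {v} v∈ with P? v | ≡.trans (≡.sym (lookup∘tabulate (does ∘ P?) v)) ([]=⇒lookup v∈)
... | yes Pv | _  = Pv
... | no _   | ()

∣toSubset∣≡count : ∀ {n ℓ} {P : Pred (Fin n) ℓ} (P? : Decidable P) → Sub.∣ toSubset P? ∣ ≡ count P?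
∣toSubset∣≡count {zero} P? = refl
∣toSubset∣≡count {suc n} P? with P? zero
... | yes _ = cong suc (∣toSubset∣≡count (P? ∘ suc))
... | no _  = ∣toSubset∣≡count (P? ∘ suc)

module Extension {n t} (G : Graph n) (clawFree : ClawFree G) (L : Assignment n t)
  {M : ℕ} (bounded : ∀ v {a} → a ∈ lst L v → a < M) (K : ℕ) where

  newColours : List ℕ
  newColours = applyUpTo (M +_) K

  oldOrNew : ∀ {v x} → x ∈ lst L v ++ newColours → (x ∈ lst L v × x < M) ⊎ ∃[ j ] j < K × x ≡ M + j
  oldOrNew {v} x∈ with ∈-++⁻ (lst L v) x∈
  ... | inj₁ x∈L   = inj₁ (x∈L , bounded v x∈L)
  ... | inj₂ x∈new = inj₂ (∈-applyUpTo⁻ (M +_) x∈new)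

  old∈lst : ∀ {v x} → x ∈ lst L v ++ newColours → x < M → x ∈ lst L v
  old∈lst x∈ x<M with oldOrNew x∈
  ... | inj₁ (x∈L , _)        = x∈L
  ... | inj₂ (j , _ , x≡M+j) = contradiction (subst (_< M) x≡M+j x<M) (m+n≮m M j)

  extended : Assignment n (t + K)
  extended = record
    { lst    = λ v → lst L v ++ newColours
    ; size   = λ v → ≡.trans (length-++ (lst L v)) (≡.cong₂ _+_ (size L v) (length-applyUpTo (M +_) K))
    ; unique = λ v → Unique.++⁺ (unique L v)
                 (Unique.applyUpTo⁺₁ (M +_) K λ i<j _ → <⇒≢ i<j ∘ +-cancelˡ-≡ M _ _)
                 λ (x∈L , x∈new) → let (j , _ , x≡M+j) = ∈-applyUpTo⁻ (M +_) x∈new in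
                   m+n≮m M j (subst (_< M) x≡M+j (bounded v x∈L)) }

  record Colouring : Set where
    field
      colour   : Fin n → ℕ
      fromList : ∀ v → colour v ∈ lst extended v
      proper   : ProperColouring G colour

  module _ (C : Colouring) where
    open Colouring C

    colourClass? : (x : ℕ) → Decidable (λ v → colour v ≡ x)
    colourClass? x v = colour v ≟ x

    colourClassListing? : (β a : ℕ) → Decidable (λ v → colour v ≡ β × a ∈ lst L v)
    colourClassListing? β a v = colourClass? β v ×-dec (a ∈? lst L v)

    old? : Decidable (λ v → colour v < M)
    old? = (_<? M) ∘ colour

  old : Colouring → ℕ
  old C = count (old? C)

  BalancedAt : Colouring → Fin K → Fin M → Set
  BalancedAt C i a = count (colourClassListing? C (M + toℕ i) (toℕ a)) ≤ count (colourClass? C (toℕ a))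

  balancedAt? : ∀ C i a → Dec (BalancedAt C i a)
  balancedAt? C i a = _ ≤? _

  Balanced : Colouring → Set
  Balanced C = ∀ i a → BalancedAt C i a

  improvable : ∀ C i a → ¬ BalancedAt C i a → ∃[ C' ] old C < old C'
  improvable C i a unbalanced = C' , swapped-increases (_<? M) (toℕ<n a) (m+n≮m M (toℕ i)) surplus
    where
    open Colouring C
    β = M + toℕ i
    open Peeling G (colourClass? C β)
      (clawFree⇒atMostTwoNeighboursIn G clawFree (colourClass-independent G proper β))
    open ClosedSurplus (closedSurplus _ (colourClassListing? C β (toℕ a)) (colourClass? C (toℕ a)) proj₁ ≤-refl
                          (≰⇒> unbalanced))
    α≢β : toℕ a ≢ β
    α≢β = <⇒≢ (<-≤-trans (toℕ<n a) (m≤m+n M (toℕ i)))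
    open KempeSwap G proper α≢β A? B? (proj₁ ∘ A⊆X) B⊆Y A-closed B-closed
    swapped-fromList : ∀ v → swapped v ∈ lst extended v
    swapped-fromList v with view v
    ... | inA Av _ s    = subst (_∈ _) (≡.sym s) (∈-++⁺ˡ (proj₂ (A⊆X Av)))
    ... | inB _ _ s     = subst (_∈ _) (≡.sym s) (∈-++⁺ʳ (lst L v) (∈-applyUpTo⁺ (M +_) (toℕ<n i)))
    ... | outside _ _ s = subst (_∈ _) (≡.sym s) (fromList v)
    C' : Colouring
    C' = record { colour = swapped ; fromList = swapped-fromList ; proper = swapped-proper }

  balancedOrImprovable : ∀ C → Balanced C ⊎ ∃[ C' ] old C < old C'
  balancedOrImprovable C with all? (λ i → all? (balancedAt? C i))
  ... | yes balanced = inj₁ balanced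
  ... | no unbalanced
    with i , ¬balanced-i ← ¬∀⟶∃¬ K _ (λ i → all? (balancedAt? C i)) unbalanced
    with a , ¬balanced-ia ← ¬∀⟶∃¬ M _ (balancedAt? C i) ¬balanced-i
    = inj₂ (improvable C i a ¬balanced-ia)

  module Counting (C : Colouring) where
    open Colouring C

    oldOrOneNew : ∀ v → 𝟙 (old? C v) + ∑[ i < K ] 𝟙 (colour v ≟ M + toℕ i) ≡ 1
    oldOrOneNew v with oldOrNew (fromList v)
    ... | inj₁ (_ , cv<M) rewrite 𝟙-yes (old? C v) cv<M = cong suc (≡.trans
      (sum-cong-≗ {K} λ i → 𝟙-no (colour v ≟ M + toℕ i) λ cv≡ → m+n≮m M (toℕ i) (subst (_< M) cv≡ cv<M))
      (sum-replicate-zero K))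
    ... | inj₂ (j , j<K , cv≡M+j) rewrite 𝟙-no (old? C v) (m+n≮m M j ∘ subst (_< M) cv≡M+j) = begin
      ∑[ i < K ] 𝟙 (colour v ≟ M + toℕ i)  ≡⟨ sum-cong-≗ {K} (λ i → 𝟙-cong (colour v ≟ M + toℕ i) (j ≟ toℕ i)
                                                (+-cancelˡ-≡ M _ _ ∘ ≡.trans (≡.sym cv≡M+j))
                                                (≡.trans cv≡M+j ∘ cong (M +_))) ⟩
      ∑[ i < K ] 𝟙 (j ≟ toℕ i)             ≡⟨ ∑-𝟙-≟toℕ K j ⟩
      𝟙 (j <? K)                            ≡⟨ 𝟙-yes (j <? K) j<K ⟩
      1                                     ∎
      where open ≡.≡-Reasoning

    old+new≡n : old C + ∑[ i < K ] count (colourClass? C (M + toℕ i)) ≡ n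
    old+new≡n = begin
      old C + ∑[ i < K ] ∑[ v < n ] 𝟙 (colour v ≟ M + toℕ i)
        ≡⟨ cong (old C +_) (∑-comm {K} {n} (λ i v → 𝟙 (colour v ≟ M + toℕ i))) ⟩
      old C + ∑[ v < n ] ∑[ i < K ] 𝟙 (colour v ≟ M + toℕ i)
        ≡⟨ ∑-distrib-+ {n} (𝟙 ∘ old? C) (λ v → ∑[ i < K ] 𝟙 (colour v ≟ M + toℕ i)) ⟨
      ∑[ v < n ] (𝟙 (old? C v) + ∑[ i < K ] 𝟙 (colour v ≟ M + toℕ i))
        ≡⟨ sum-cong-≗ {n} oldOrOneNew ⟩
      ∑[ v < n ] 1
        ≡⟨ ≡.trans (∑-const n 1) (*-identityʳ n) ⟩
      n ∎
      where open ≡.≡-Reasoning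

    ∑-colourClass≡old : ∑[ a < M ] count (colourClass? C (toℕ a)) ≡ old C
    ∑-colourClass≡old = begin
      ∑[ a < M ] ∑[ v < n ] 𝟙 (colour v ≟ toℕ a)  ≡⟨ ∑-comm {M} {n} (λ a v → 𝟙 (colour v ≟ toℕ a)) ⟩
      ∑[ v < n ] ∑[ a < M ] 𝟙 (colour v ≟ toℕ a)  ≡⟨ sum-cong-≗ {n} (λ v → ∑-𝟙-≟toℕ M (colour v)) ⟩
      old C                                       ∎
      where open ≡.≡-Reasoning

    ∑-colourClassListing≡ : ∀ β → ∑[ a < M ] count (colourClassListing? C β (toℕ a)) ≡ count (colourClass? C β) * t
    ∑-colourClassListing≡ β = begin
      ∑[ a < M ] ∑[ v < n ] 𝟙 (colourClassListing? C β (toℕ a) v)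
        ≡⟨ ∑-comm {M} {n} (λ a v → 𝟙 (colourClassListing? C β (toℕ a) v)) ⟩
      ∑[ v < n ] ∑[ a < M ] 𝟙 (colourClassListing? C β (toℕ a) v)
        ≡⟨ sum-cong-≗ {n} (λ v → sum-cong-≗ {M} (λ a → 𝟙-× (colour v ≟ β) (toℕ a ∈? lst L v))) ⟩
      ∑[ v < n ] ∑[ a < M ] (𝟙 (colour v ≟ β) * 𝟙 (toℕ a ∈? lst L v))
        ≡⟨ sum-cong-≗ {n} (λ v → *-distribˡ-sum {M} (𝟙 (colour v ≟ β)) (λ a → 𝟙 (toℕ a ∈? lst L v))) ⟨
      ∑[ v < n ] (𝟙 (colour v ≟ β) * ∑[ a < M ] 𝟙 (toℕ a ∈? lst L v))
        ≡⟨ sum-cong-≗ {n} (λ v → cong (𝟙 (colour v ≟ β) *_) (listSize v)) ⟩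
      ∑[ v < n ] (𝟙 (colour v ≟ β) * t)
        ≡⟨ *-distribʳ-sum t (𝟙 ∘ colourClass? C β) ⟨
      count (colourClass? C β) * t ∎
      where
      open ≡.≡-Reasoning
      listSize : ∀ v → ∑[ a < M ] 𝟙 (toℕ a ∈? lst L v) ≡ t
      listSize v = ≡.trans (∑-𝟙-∈ M (unique L v) (All.tabulate (bounded v))) (size L v)

    balanced⇒newClass≤old : Balanced C → ∀ i → count (colourClass? C (M + toℕ i)) * t ≤ old C
    balanced⇒newClass≤old balanced i = begin
      count (colourClass? C (M + toℕ i)) * t                         ≡⟨ ∑-colourClassListing≡ (M + toℕ i) ⟨
      ∑[ a < M ] count (colourClassListing? C (M + toℕ i) (toℕ a))  ≤⟨ ∑-mono-≤ (balanced i) ⟩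
      ∑[ a < M ] count (colourClass? C (toℕ a))                      ≡⟨ ∑-colourClass≡old ⟩
      old C                                                          ∎
      where open ≤-Reasoning

    balanced⇒bound : Balanced C → t * n ≤ (t + K) * old C
    balanced⇒bound balanced = begin
      t * n                                        ≡⟨ cong (t *_) old+new≡n ⟨
      t * (old C + new)                            ≡⟨ *-distribˡ-+ t (old C) new ⟩
      t * old C + t * new                          ≡⟨ cong (t * old C +_) (*-comm t new) ⟩
      t * old C + new * t                          ≡⟨ cong (t * old C +_) (*-distribʳ-sum t newClass) ⟩
      t * old C + ∑[ i < K ] (newClass i * t)      ≤⟨ +-monoʳ-≤ (t * old C) (∑-mono-≤ (balanced⇒newClass≤old balanced)) ⟩
      t * old C + ∑[ i < K ] old C                 ≡⟨ cong (t * old C +_) (∑-const K (old C)) ⟩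
      t * old C + K * old C                        ≡⟨ *-distribʳ-+ (old C) t K ⟨
      (t + K) * old C                              ∎
      where
      open ≤-Reasoning
      newClass : Fin K → ℕ
      newClass i = count (colourClass? C (M + toℕ i))
      new : ℕ
      new = ∑[ i < K ] newClass i

  balancedColouring : Choosable G (t + K) → ∃ Balanced
  balancedColouring choosable = ∃-by-bounded-ascent old (count≤n ∘ old?) balancedOrImprovable initial
    where
    initial : Colouring
    initial = let (c , fromList , proper) = choosable extended in record
      { colour = c ; fromList = fromList ; proper = proper }

  balanced⇒oldPartLarge : ∀ C → Balanced C →
    Σ (Subset n) λ S → ListColourableOn G L S × t * n ≤ (t + K) * Sub.∣ S ∣
  balanced⇒oldPartLarge C balanced = toSubset (old? C) , colourableOn , large
    where
    open Colouring C
    colourableOn : ListColourableOn G L (toSubset (old? C))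
    colourableOn = colour
      , (λ v v∈S → old∈lst (fromList v) (∈-toSubset⁻ (old? C) v∈S))
      , λ u v _ _ → proper u v
    large : t * n ≤ (t + K) * Sub.∣ toSubset (old? C) ∣
    large = subst (λ m → t * n ≤ (t + K) * m) (≡.sym (∣toSubset∣≡count (old? C)))
              (Counting.balanced⇒bound C balanced)

mainTheorem1 : ∀ (n : ℕ) (G : Graph n) (s : ℕ) → ClawFree G →
    ListChromaticNumber G s → ∀ (t : ℕ) → 0 < t → t < s → LambdaBound G t s
mainTheorem1 n G s clawFree (choosable , _) t _ t<s L
  with K , refl ← m≤n⇒∃[o]m+o≡n (<⇒≤ t<s)
  with M , bounded ← listsBounded (lst L)
  with C , balanced ← Extension.balancedColouring G clawFree L bounded K choosable
  = Extension.balanced⇒oldPartLarge G clawFree L bounded K C balanced
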